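{- Let $\Gamma$ be a commutative weakly distance-regular digraph whose underlying graph $\Sigma$ is distance-regular with $c_2=2$. Let $p,s\ge2$ be integers with $(1,p-1),(1,s-1),(2,2)\in\tilde\partial(\Gamma)$ and $p^{(2,2)}_{(1,p-1),(1,s-1)}\ne0$. Then $p=s$. Moreover, exactly one of the following holds: (i) $p=2$ and $p^{(2,2)}_{(1,1),(1,1)}=2$; (ii) $p\in\{3,4\}$ and $p^{(2,2)}_{(1,p-1),(1,p-1)}=1$.
   Context: Digraphs have arcs as ordered pairs of distinct vertices; $\partial_\Gamma$ is directed distance, $\tilde\partial_\Gamma(x,y)=(\partial_\Gamma(x,y),\partial_\Gamma(y,x))$, $\tilde\partial(\Gamma)$ is the set of these pairs, $P_{\tilde i,\tilde j}(x,y)=\{z:\tilde\partial_\Gamma(x,z)=\tilde i,\tilde\partial_\Gamma(z,y)=\tilde j\}$. A strongly connected $\Gamma$ is weakly distance-regular if for $\tilde h,\tilde i,\tilde j\in\tilde\partial(\Gamma)$, $|P_{\tilde i,\tilde j}(x,y)|=p^{\tilde h}_{\tilde i,\tilde j}$ whenever $\tilde\partial_\Gamma(x,y)=\tilde h$; commutative if $p^{\tilde h}_{\tilde i,\tilde j}=p^{\tilde h}_{\tilde j,\tilde i}$. The underlying graph $\Sigma$ has $x\sim y$ iff $(x,y)$ or $(y,x)$ is an arc. For a distance-regular graph, $c_2$ is the number of common neighbours of two vertices at distance $2$. -}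

module Defs where

open import Data.Nat using (ℕ; zero; suc; _≟_; _∸_)
open import Data.Bool using (Bool; true; false; if_then_else_; _∨_; _∧_)
open import Data.Fin using (Fin) renaming (_≟_ to _≟ᶠ_)
open import Data.List using (List; allFin; filter; length)
open import Data.Bool.ListAction using (any)
open import Data.Product using (_×_; _,_; ∃; ∃-syntax; Σ-syntax)
open import Data.Product.Properties using (≡-dec)
open import Relation.Nullary using (¬_; Dec; does)
open import Relation.Binary.PropositionalEquality using (_≡_)

Adj : ℕ → Set
Adj n = Fin n → Fin n → Bool

Loopless : ∀ {n} → Adj n → Set
Loopless {n} A = ∀ (x : Fin n) → A x x ≡ false

within : ∀ {n} → Adj n → ℕ → Fin n → Fin n → Bool
within A zero    x y = does (x ≟ᶠ y)
within {n} A (suc k) x y = within A k x y ∨ any (λ z → within A k x z ∧ A z y) (allFin n)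

search : (ℕ → Bool) → ℕ → ℕ → ℕ
search P k zero    = k
search P k (suc f) = if P k then k else search P (suc k) f

-- Directed distance ∂(x,y): length of a shortest directed walk from x to y
-- (every such distance is < n; the value n is returned if y is unreachable,
-- which never happens for strongly connected digraphs).
dist : ∀ {n} → Adj n → Fin n → Fin n → ℕ
dist {n} A x y = search (λ k → within A k x y) 0 n

StronglyConnected : ∀ {n} → Adj n → Set
StronglyConnected {n} A = ∀ (x y : Fin n) → ∃[ k ] (within A k x y ≡ true)

tdist : ∀ {n} → Adj n → Fin n → Fin n → ℕ × ℕ
tdist A x y = (dist A x y , dist A y x)

InTDist : ∀ {n} → Adj n → ℕ × ℕ → Set
InTDist {n} A h = ∃[ x ] ∃[ y ] (tdist {n} A x y ≡ h)

_≟²_ : (a b : ℕ × ℕ) → Dec (a ≡ b)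
_≟²_ = ≡-dec _≟_ _≟_

countP : ∀ {n} → Adj n → ℕ × ℕ → ℕ × ℕ → Fin n → Fin n → ℕ
countP {n} A i j x y =
  length (filter (λ z → (tdist A x z ≟² i)) (filter (λ z → (tdist A z y ≟² j)) (allFin n)))

record WeaklyDistanceRegular {n : ℕ} (A : Adj n) : Set where
  field
    loopless  : Loopless A
    strong    : StronglyConnected A
    p         : ℕ × ℕ → ℕ × ℕ → ℕ × ℕ → ℕ
    regular   : ∀ h i j → InTDist A h → InTDist A i → InTDist A j →
                ∀ x y → tdist A x y ≡ h → countP A i j x y ≡ p h i j

Commutative : ∀ {n} {A : Adj n} → WeaklyDistanceRegular A → Set
Commutative {n} {A} W = ∀ h i j → InTDist A h → InTDist A i → InTDist A j →
  WeaklyDistanceRegular.p W h i j ≡ WeaklyDistanceRegular.p W h j i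

underlying : ∀ {n} → Adj n → Adj n
underlying A x y = A x y ∨ A y x

-- For an undirected graph G (symmetric adjacency), dist G is the usual path distance.
-- #{ z : d(x,z) = i , d(z,y) = j }
countU : ∀ {n} → Adj n → ℕ → ℕ → Fin n → Fin n → ℕ
countU {n} G i j x y =
  length (filter (λ z → dist G x z ≟ i) (filter (λ z → dist G z y ≟ j) (allFin n)))

DistanceRegular : ∀ {n} → Adj n → Set
DistanceRegular {n} G =
  (∀ (x y : Fin n) → ∃[ k ] (within G k x y ≡ true)) ×
  Σ[ a ∈ (ℕ → ℕ → ℕ → ℕ) ] (∀ (x y : Fin n) (i j : ℕ) → countU G i j x y ≡ a (dist G x y) i j)

C2 : ∀ {n} → Adj n → ℕ → Set
C2 {n} G c = ∀ (x y : Fin n) → dist G x y ≡ 2 → countU G 1 1 x y ≡ c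

{-# OPTIONS --safe #-}
-- Fix x, y with ∂̃(x,y) = (2,2). Neither direction is an arc, so ∂_Σ(x,y) = 2 and by c₂ = 2
-- x and y have exactly two common neighbours in Σ. One of them is the middle vertex u of a
-- directed path y → u → x; a vertex z₀ of P_{(1,p-1),(1,s-1)}(x,y) is another, and by
-- commutativity so is some z₁ of P_{(1,s-1),(1,p-1)}(x,y). If z₀ ≠ z₁, then u is one of them,
-- which forces p − 1 = s − 1 = 1; hence p = s. If p = 2, let c be any common neighbour, with
-- a = ∂̃(x,c) and b = ∂̃(c,y); transposing and reversing, P_{b,a}(x,y) and P_{b⁻¹,a⁻¹}(x,y)
-- are nonempty, and placing their vertices among {z₀, c} forces a = b = (1,1). So
-- P_{(1,1),(1,1)}(x,y) is the set of common neighbours and its size is c₂. If p ≠ 2, then u ≠ z₀ is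
-- the only other common neighbour, so z₀ is alone in P_{(1,p-1),(1,p-1)}(x,y), and the walk
-- z₀ → y → u → x gives p − 1 ≤ 3.
module Submission where

open import Defs
open import Data.Bool using (Bool; true; false; T; _∧_)
open import Data.Bool.ListAction using (any)
open import Data.Bool.Properties using (T-∨; T-∧; T-≡)
open import Data.Fin using (Fin; zero; suc) renaming (_≟_ to _≟ᶠ_)
open import Data.Fin.Properties using (toℕ<n; injective⇒≤)
open import Data.List using (List; []; _∷_; filter; length; allFin)
open import Data.List.Membership.Propositional using (_∈_; lose)
open import Data.List.Membership.Propositional.Properties using (∈-allFin; ∈-filter⁺; ∈-filter⁻)
open import Data.List.Properties using (filter-≐; filter-some)
open import Data.List.Relation.Unary.All using (_∷_)
open import Data.List.Relation.Unary.AllPairs using (_∷_)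
open import Data.List.Relation.Unary.Any using (here; there; satisfied)
open import Data.List.Relation.Unary.Any.Properties using (any⁺; any⁻)
open import Data.List.Relation.Unary.Unique.Propositional using (Unique)
open import Data.List.Relation.Unary.Unique.Propositional.Properties using (allFin⁺; filter⁺)
open import Data.Nat using (ℕ; zero; suc; _+_; _≤_; _<_; _∸_; z≤n; s≤s) renaming (_≟_ to _≟ℕ_)
open import Data.Nat.Properties
  using (≤∧≢⇒<; ≤-<-trans; ≤-antisym; ≤-refl; <⇒≤; <⇒≢; n≤0⇒n≡0; n≢0⇒n>0; n>0⇒n≢0; ∸-cancelʳ-≡; +-identityʳ; +-suc)
open import Data.Product using (_×_; _,_; proj₁; proj₂; ∃; ∃-syntax; swap)
open import Data.Sum as Sum using (_⊎_; inj₁; inj₂; [_,_]′)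
open import Function using (_∘_; Equivalence; Injective)
open import Relation.Nullary using (¬_; yes; no; contradiction)
open import Relation.Nullary.Decidable using (dec-true)
open import Relation.Unary using (Pred; Decidable; _≐_)
open import Relation.Unary.Properties using (_∩?_)
open import Relation.Binary.PropositionalEquality using (_≡_; _≢_; refl; sym; trans; cong; subst; module ≡-Reasoning)

length≢0⇒∈ : ∀ {a} {A : Set a} (xs : List A) → length xs ≢ 0 → ∃[ z ] z ∈ xs
length≢0⇒∈ []      len≢0 = contradiction refl len≢0
length≢0⇒∈ (x ∷ _) _     = x , here refl

length≡1 : ∀ {a} {A : Set a} {xs : List A} {x : A} →
           Unique xs → x ∈ xs → (∀ {z} → z ∈ xs → z ≡ x) → length xs ≡ 1
length≡1 {xs = _ ∷ []}    _                  _ _   = refl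
length≡1 {xs = _ ∷ _ ∷ _} ((v≢w ∷ _) ∷ _) _ ≡x =
  contradiction (trans (≡x (here refl)) (sym (≡x (there (here refl))))) v≢w

∈-pair⁻ : ∀ {a} {A : Set a} {z v w : A} → z ∈ v ∷ w ∷ [] → z ≡ v ⊎ z ≡ w
∈-pair⁻ (here z≡v)         = inj₁ z≡v
∈-pair⁻ (there (here z≡w)) = inj₂ z≡w

length≡2⇒≡⊎≡ : ∀ {a} {A : Set a} {xs : List A} {x y z : A} → length xs ≡ 2 →
               x ∈ xs → y ∈ xs → x ≢ y → z ∈ xs → z ≡ x ⊎ z ≡ y
length≡2⇒≡⊎≡ {xs = _ ∷ _ ∷ []} refl x∈ y∈ x≢y z∈
  with ∈-pair⁻ x∈ | ∈-pair⁻ y∈ | ∈-pair⁻ z∈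
... | inj₁ refl | inj₁ refl | _   = contradiction refl x≢y
... | inj₁ refl | inj₂ refl | z≡  = z≡
... | inj₂ refl | inj₁ refl | z≡  = Sum.swap z≡
... | inj₂ refl | inj₂ refl | _   = contradiction refl x≢y

module _ {a p q} {A : Set a} {P : Pred A p} {Q : Pred A q} (P? : Decidable P) (Q? : Decidable Q) where

  filter-filter : ∀ xs → filter P? (filter Q? xs) ≡ filter (P? ∩? Q?) xs
  filter-filter []       = refl
  filter-filter (x ∷ xs) with Q? x
  ... | no _ with P? x
  ...   | yes _ = filter-filter xs
  ...   | no  _ = filter-filter xs
  filter-filter (x ∷ xs) | yes _ with P? x
  ...   | yes _ = cong (x ∷_) (filter-filter xs)
  ...   | no  _ = filter-filter xs

count : ∀ {n ℓ} {R : Pred (Fin n) ℓ} → Decidable R → ℕ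
count {n} R? = length (filter R? (allFin n))

module _ {n ℓ} {R : Pred (Fin n) ℓ} (R? : Decidable R) where

  private
    ∈-filter-allFin : ∀ {z} → R z → z ∈ filter R? (allFin n)
    ∈-filter-allFin = ∈-filter⁺ R? (∈-allFin _)

    ∈-filter-allFin⁻ : ∀ {z} → z ∈ filter R? (allFin n) → R z
    ∈-filter-allFin⁻ = proj₂ ∘ ∈-filter⁻ R? {xs = allFin n}

  count≢0⇒∃ : count R? ≢ 0 → ∃ R
  count≢0⇒∃ count≢0 with z , z∈ ← length≢0⇒∈ _ count≢0 = z , ∈-filter-allFin⁻ z∈

  ∃⇒count≢0 : ∀ {z} → R z → count R? ≢ 0
  ∃⇒count≢0 Rz = n>0⇒n≢0 (filter-some R? {xs = allFin n} (lose (∈-allFin _) Rz))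

  count≡1 : ∀ {x} → R x → (∀ {z} → R z → z ≡ x) → count R? ≡ 1
  count≡1 Rx ≡x = length≡1 (filter⁺ R? (allFin⁺ n)) (∈-filter-allFin Rx) (≡x ∘ ∈-filter-allFin⁻)

  count≡2⇒≡⊎≡ : ∀ {x y z} → count R? ≡ 2 → R x → R y → x ≢ y → R z → z ≡ x ⊎ z ≡ y
  count≡2⇒≡⊎≡ count≡2 Rx Ry x≢y Rz =
    length≡2⇒≡⊎≡ count≡2 (∈-filter-allFin Rx) (∈-filter-allFin Ry) x≢y (∈-filter-allFin Rz)

distinct³⇒3≤n : ∀ {n} {x y z : Fin n} → x ≢ y → x ≢ z → y ≢ z → 3 ≤ n
distinct³⇒3≤n {n} {x} {y} {z} x≢y x≢z y≢z = injective⇒≤ {f = f} f-injective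
  where
  f : Fin 3 → Fin n
  f zero             = x
  f (suc zero)       = y
  f (suc (suc zero)) = z

  f-injective : Injective _≡_ _≡_ f
  f-injective {zero}             {zero}             _ = refl
  f-injective {zero}             {suc zero}         e = contradiction e x≢y
  f-injective {zero}             {suc (suc zero)}   e = contradiction e x≢z
  f-injective {suc zero}         {zero}             e = contradiction (sym e) x≢y
  f-injective {suc zero}         {suc zero}         _ = refl
  f-injective {suc zero}         {suc (suc zero)}   e = contradiction e y≢z
  f-injective {suc (suc zero)}   {zero}             e = contradiction (sym e) x≢z
  f-injective {suc (suc zero)}   {suc zero}         e = contradiction (sym e) y≢z
  f-injective {suc (suc zero)}   {suc (suc zero)}   _ = refl

pred≡⇒≡ : ∀ {p s} → 2 ≤ p → 2 ≤ s → p ∸ 1 ≡ s ∸ 1 → p ≡ s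
pred≡⇒≡ 2≤p 2≤s = ∸-cancelʳ-≡ (<⇒≤ 2≤p) (<⇒≤ 2≤s)

pred≤3⇒≡3⊎≡4 : ∀ {p} → 2 ≤ p → p ≢ 2 → p ∸ 1 ≤ 3 → p ≡ 3 ⊎ p ≡ 4
pred≤3⇒≡3⊎≡4 {1}           (s≤s ()) _ _
pred≤3⇒≡3⊎≡4 {2}           _ p≢2 _ = contradiction refl p≢2
pred≤3⇒≡3⊎≡4 {3}           _ _   _ = inj₁ refl
pred≤3⇒≡3⊎≡4 {4}           _ _   _ = inj₂ refl
pred≤3⇒≡3⊎≡4 {suc (suc (suc (suc (suc _))))} _ _ (s≤s (s≤s (s≤s ())))

search-minimal : ∀ (P : ℕ → Bool) k f {m} → T (P m) → k ≤ m → search P k f ≤ m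
search-minimal P k zero    _  k≤m = k≤m
search-minimal P k (suc f) Pm k≤m with P k in Pk
... | true  = k≤m
... | false = search-minimal P (suc k) f Pm (≤∧≢⇒< k≤m λ { refl → subst T Pk Pm })

search-found : ∀ (P : ℕ → Bool) k f → search P k f ≡ k + f ⊎ T (P (search P k f))
search-found P k zero    = inj₁ (sym (+-identityʳ k))
search-found P k (suc f) with P k in Pk
... | true  = inj₂ (subst T (sym Pk) _)
... | false = Sum.map₁ (λ found → trans found (sym (+-suc k f))) (search-found P (suc k) f)

module _ {n} (A : Adj n) where

  within-refl : ∀ x → T (within A 0 x x)
  within-refl x = Equivalence.from T-≡ (dec-true (x ≟ᶠ x) refl)

  within-zero⁻ : ∀ {x y} → T (within A 0 x y) → x ≡ y
  within-zero⁻ {x} {y} w with x ≟ᶠ y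
  within-zero⁻ _  | yes x≡y = x≡y
  within-zero⁻ () | no _

  within-suc⁻ : ∀ {k x y} → T (within A (suc k) x y) →
                T (within A k x y) ⊎ ∃[ z ] T (within A k x z) × T (A z y)
  within-suc⁻ {k} {x} {y} w = Sum.map₂ last-arc (Equivalence.to T-∨ w)
    where
    last-arc : T (any (λ z → within A k x z ∧ A z y) (allFin n)) → ∃[ z ] T (within A k x z) × T (A z y)
    last-arc t with z , t′ ← satisfied (any⁻ (λ z → within A k x z ∧ A z y) (allFin n) t) =
      z , Equivalence.to T-∧ t′

  within-snoc : ∀ k x z y → T (within A k x z) → T (A z y) → T (within A (suc k) x y)
  within-snoc k x z y w a =
    Equivalence.from T-∨ (inj₂ (any⁺ _ (lose (∈-allFin z) (Equivalence.from T-∧ (w , a)))))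

  within-one⁻ : ∀ {x y} → T (within A 1 x y) → x ≡ y ⊎ T (A x y)
  within-one⁻ {x} {y} w with within-suc⁻ {0} {x} {y} w
  ... | inj₁ w₀            = inj₁ (within-zero⁻ w₀)
  ... | inj₂ (_ , w₀ , a) with refl ← within-zero⁻ {x} w₀ = inj₂ a

  dist-minimal : ∀ {k x y} → T (within A k x y) → dist A x y ≤ k
  dist-minimal w = search-minimal _ 0 n w z≤n

  -- dist returns n when y is not reached within n − 1 steps, hence the hypothesis d < n.
  dist≡⇒within : ∀ {d x y} → dist A x y ≡ d → d < n → T (within A d x y)
  dist≡⇒within {x = x} {y} refl d<n =
    [ (λ d≡n → contradiction d≡n (<⇒≢ d<n)) , (λ w → w) ]′ (search-found (λ k → within A k x y) 0 n)

  dist-refl : ∀ x → dist A x x ≡ 0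
  dist-refl x = n≤0⇒n≡0 (dist-minimal (within-refl x))

  dist≡0⇒≡ : ∀ {x y} → dist A x y ≡ 0 → x ≡ y
  dist≡0⇒≡ {x} d≡0 = within-zero⁻ (dist≡⇒within d≡0 (≤-<-trans z≤n (toℕ<n x)))

  arc⇒dist≡1 : Loopless A → ∀ {x y} → T (A x y) → dist A x y ≡ 1
  arc⇒dist≡1 loopless {x} a = ≤-antisym (dist-minimal (within-snoc 0 x x _ (within-refl x) a)) (n≢0⇒n>0 d≢0)
    where
    d≢0 : dist A x _ ≢ 0
    d≢0 d≡0 with refl ← dist≡0⇒≡ d≡0 = subst T (loopless x) a

  dist≡1⇒arc : 1 < n → ∀ {x y} → dist A x y ≡ 1 → T (A x y)
  dist≡1⇒arc 1<n {x} {y} d≡1 with within-one⁻ {x} {y} (dist≡⇒within d≡1 1<n)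
  ... | inj₁ refl = contradiction (trans (sym d≡1) (dist-refl x)) λ ()
  ... | inj₂ a    = a

  dist≡2⇒path : 2 < n → ∀ {x y} → dist A x y ≡ 2 → ∃[ c ] T (A x c) × T (A c y)
  dist≡2⇒path 2<n {x} {y} d≡2 with within-suc⁻ {1} {x} {y} (dist≡⇒within d≡2 2<n)
  ... | inj₁ w₁ = contradiction (subst (_≤ 1) d≡2 (dist-minimal w₁)) λ { (s≤s ()) }
  ... | inj₂ (c , w₁ , c→y) with within-one⁻ {x} {c} w₁
  ...   | inj₁ refl =
    contradiction (subst (_≤ 1) d≡2 (dist-minimal (within-snoc 0 x x y (within-refl x) c→y))) λ { (s≤s ()) }
  ...   | inj₂ x→c  = c , x→c , c→y

  path⇒dist≡2 : 1 < n → ∀ {x c y} → x ≢ y → ¬ T (A x y) → T (A x c) → T (A c y) → dist A x y ≡ 2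
  path⇒dist≡2 1<n {x} {c} {y} x≢y x↛y x→c c→y =
    exactly-2 (dist-minimal (within-snoc 1 x c y (within-snoc 0 x x c (within-refl x) x→c) c→y))
    (x≢y ∘ dist≡0⇒≡) (x↛y ∘ dist≡1⇒arc 1<n)
    where
    exactly-2 : ∀ {d} → d ≤ 2 → d ≢ 0 → d ≢ 1 → d ≡ 2
    exactly-2 z≤n             d≢0 _   = contradiction refl d≢0
    exactly-2 (s≤s z≤n)       _   d≢1 = contradiction refl d≢1
    exactly-2 (s≤s (s≤s z≤n)) _   _   = refl

  dist≡2⇒dist≡1⇒2<n : ∀ {x y z} → dist A x y ≡ 2 → dist A x z ≡ 1 → 2 < n
  dist≡2⇒dist≡1⇒2<n {x} {y} {z} xy xz = distinct³⇒3≤n x≢y x≢z y≢z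
    where
    x≢y : x ≢ y
    x≢y refl = contradiction (trans (sym xy) (dist-refl x)) λ ()
    x≢z : x ≢ z
    x≢z refl = contradiction (trans (sym xz) (dist-refl x)) λ ()
    y≢z : y ≢ z
    y≢z refl = contradiction (trans (sym xy) xz) λ ()

Adjacent : ℕ × ℕ → Set
Adjacent (i , j) = i ≡ 1 ⊎ j ≡ 1

Adjacent-swap : ∀ {t} → Adjacent t → Adjacent (swap t)
Adjacent-swap = Sum.swap

Adjacent-symmetric : ∀ {t} → Adjacent t → swap t ≡ t → t ≡ (1 , 1)
Adjacent-symmetric (inj₁ refl) refl = refl
Adjacent-symmetric (inj₂ refl) refl = refl

underlying-loopless : ∀ {n} {A : Adj n} → Loopless A → Loopless (underlying A)
underlying-loopless loopless x rewrite loopless x = refl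

module _ {n} {A : Adj n} (loopless : Loopless A) (1<n : 1 < n) where

  Adjacent⇒underlying : ∀ {a b} → Adjacent (tdist A a b) → T (underlying A a b)
  Adjacent⇒underlying = Equivalence.from T-∨ ∘ Sum.map (dist≡1⇒arc A 1<n) (dist≡1⇒arc A 1<n)

  underlying⇒Adjacent : ∀ {a b} → T (underlying A a b) → Adjacent (tdist A a b)
  underlying⇒Adjacent = Sum.map (arc⇒dist≡1 A loopless) (arc⇒dist≡1 A loopless) ∘ Equivalence.to T-∨

InP : ∀ {n} → Adj n → ℕ × ℕ → ℕ × ℕ → Fin n → Fin n → Fin n → Set
InP A i j x y z = tdist A x z ≡ i × tdist A z y ≡ j

InP? : ∀ {n} (A : Adj n) i j x y → Decidable (InP A i j x y)
InP? A i j x y = (λ z → tdist A x z ≟² i) ∩? (λ z → tdist A z y ≟² j)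

countP≡count : ∀ {n} (A : Adj n) i j x y → countP A i j x y ≡ count (InP? A i j x y)
countP≡count {n} A i j x y = cong length (filter-filter _ _ (allFin n))

InP-types-≡ : ∀ {n} {A : Adj n} {i j i′ j′ x y z z′} →
            z ≡ z′ → InP A i j x y z → InP A i′ j′ x y z′ → i ≡ i′ × j ≡ j′
InP-types-≡ refl (xz , zy) (xz′ , zy′) = trans (sym xz) xz′ , trans (sym zy) zy′

module IntersectionNumbers {n} {A : Adj n} (W : WeaklyDistanceRegular A) where

  open WeaklyDistanceRegular W using (regular) renaming (p to pᵂ)

  p≡count : ∀ {h i j x y z} → tdist A x y ≡ h → InP A i j x y z → pᵂ h i j ≡ count (InP? A i j x y)
  p≡count {x = x} {y} {z} xy (xz , zy) =
    trans (sym (regular _ _ _ (x , y , xy) (x , z , xz) (z , y , zy) x y xy)) (countP≡count A _ _ x y)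

  InP⇒p≢0 : ∀ {h i j x y z} → tdist A x y ≡ h → InP A i j x y z → pᵂ h i j ≢ 0
  InP⇒p≢0 {i = i} {j} {x} {y} xy zP = subst (_≢ 0) (sym (p≡count xy zP)) (∃⇒count≢0 (InP? A i j x y) zP)

  p≢0⇒InP : ∀ {h i j x y} → InTDist A i → InTDist A j → tdist A x y ≡ h → pᵂ h i j ≢ 0 →
            ∃ (InP A i j x y)
  p≢0⇒InP {x = x} {y} iᵢ iⱼ xy p≢0 = count≢0⇒∃ (InP? A _ _ x y) λ count≡0 →
    p≢0 (trans (sym (regular _ _ _ (x , y , xy) iᵢ iⱼ x y xy)) (trans (countP≡count A _ _ x y) count≡0))

  InP-transport : ∀ {i j x y x′ y′ z} → tdist A x y ≡ tdist A x′ y′ → InP A i j x y z →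
                  ∃ (InP A i j x′ y′)
  InP-transport xy≡x′y′ zP@(xz , zy) = p≢0⇒InP (_ , _ , xz) (_ , _ , zy) refl (InP⇒p≢0 xy≡x′y′ zP)

  InP-reverse : ∀ {i j x y z} → tdist A y x ≡ tdist A x y → InP A i j x y z →
                ∃ (InP A (swap j) (swap i) x y)
  InP-reverse yx≡xy zP with w , yw , wx ← InP-transport (sym yx≡xy) zP = w , cong swap wx , cong swap yw

  InP-transpose : Commutative W → ∀ {i j x y z} → InP A i j x y z → ∃ (InP A j i x y)
  InP-transpose comm {x = x} {y} {z} zP@(xz , zy) =
    p≢0⇒InP (_ , _ , zy) (_ , _ , xz) refl λ p≡0 →
      InP⇒p≢0 refl zP (trans (comm _ _ _ (x , y , refl) (_ , _ , xz) (_ , _ , zy)) p≡0)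

module AtTypeTwoTwo {n} {A : Adj n} (W : WeaklyDistanceRegular A) (comm : Commutative W)
  (c₂≡2 : C2 (underlying A) 2) {x y : Fin n} (xy : tdist A x y ≡ (2 , 2)) (2<n : 2 < n) where

  open WeaklyDistanceRegular W using (loopless) renaming (p to pᵂ)
  open IntersectionNumbers W

  private
    Σ : Adj n
    Σ = underlying A

    1<n : 1 < n
    1<n = <⇒≤ 2<n

    Σ-loopless : Loopless Σ
    Σ-loopless = underlying-loopless {A = A} loopless

  Common : Fin n → Set
  Common z = dist Σ x z ≡ 1 × dist Σ z y ≡ 1

  Common? : Decidable Common
  Common? = (λ z → dist Σ x z ≟ℕ 1) ∩? (λ z → dist Σ z y ≟ℕ 1)

  Common⁺ : ∀ {z} → Adjacent (tdist A x z) → Adjacent (tdist A z y) → Common z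
  Common⁺ xz zy = arc⇒dist≡1 Σ Σ-loopless (Adjacent⇒underlying loopless 1<n xz)
                , arc⇒dist≡1 Σ Σ-loopless (Adjacent⇒underlying loopless 1<n zy)

  Common⁻ : ∀ {z} → Common z → Adjacent (tdist A x z) × Adjacent (tdist A z y)
  Common⁻ (xz , zy) = underlying⇒Adjacent loopless 1<n (dist≡1⇒arc Σ 1<n xz)
                    , underlying⇒Adjacent loopless 1<n (dist≡1⇒arc Σ 1<n zy)

  InP⇒Common : ∀ {i j z} → Adjacent i → Adjacent j → InP A i j x y z → Common z
  InP⇒Common adj-i adj-j (refl , refl) = Common⁺ adj-i adj-j

  InP₁⇒Common : ∀ {q r z} → InP A (1 , q) (1 , r) x y z → Common z
  InP₁⇒Common = InP⇒Common (inj₁ refl) (inj₁ refl)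

  Σ-dist≡2 : dist Σ x y ≡ 2
  Σ-dist≡2 with c , x→c , c→y ← dist≡2⇒path A 2<n (cong proj₁ xy) =
    path⇒dist≡2 Σ 1<n x≢y x≁y (Equivalence.from T-∨ (inj₁ x→c)) (Equivalence.from T-∨ (inj₁ c→y))
    where
    x≢y : x ≢ y
    x≢y refl = contradiction (trans (sym (cong proj₁ xy)) (dist-refl A x)) λ ()
    x≁y : ¬ T (Σ x y)
    x≁y x∼y with underlying⇒Adjacent loopless 1<n x∼y
    ... | inj₁ xy≡1 = contradiction (trans (sym (cong proj₁ xy)) xy≡1) λ ()
    ... | inj₂ yx≡1 = contradiction (trans (sym (cong proj₂ xy)) yx≡1) λ ()

  count-Common : count Common? ≡ 2
  count-Common = trans (sym (cong length (filter-filter _ _ (allFin n)))) (c₂≡2 x y Σ-dist≡2)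

  Common-pair : ∀ {a b c} → Common a → Common b → a ≢ b → Common c → c ≡ a ⊎ c ≡ b
  Common-pair = count≡2⇒≡⊎≡ Common? count-Common

  OnReturnPath : Fin n → Set
  OnReturnPath z = T (A y z) × T (A z x)

  return-vertex : ∃ OnReturnPath
  return-vertex = dist≡2⇒path A 2<n (cong proj₂ xy)

  OnReturnPath⇒Common : ∀ {z} → OnReturnPath z → Common z
  OnReturnPath⇒Common (y→z , z→x) =
    Common⁺ (inj₂ (arc⇒dist≡1 A loopless z→x)) (inj₂ (arc⇒dist≡1 A loopless y→z))

  OnReturnPath⇒types≡1 : ∀ {q r z} → OnReturnPath z → InP A (1 , q) (1 , r) x y z → q ≡ 1 × r ≡ 1
  OnReturnPath⇒types≡1 (y→z , z→x) (xz , zy) = trans (sym (cong proj₂ xz)) (arc⇒dist≡1 A loopless z→x)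
                                    , trans (sym (cong proj₂ zy)) (arc⇒dist≡1 A loopless y→z)

  Common-pair⇒OnReturnPath : ∀ {a b} → Common a → Common b → a ≢ b → OnReturnPath a ⊎ OnReturnPath b
  Common-pair⇒OnReturnPath a∼ b∼ a≢b with u , u↩ ← return-vertex
    with Common-pair a∼ b∼ a≢b (OnReturnPath⇒Common u↩)
  ... | inj₁ refl = inj₁ u↩
  ... | inj₂ refl = inj₂ u↩

  p≡s : ∀ {p s z₀} → 2 ≤ p → 2 ≤ s → InP A (1 , p ∸ 1) (1 , s ∸ 1) x y z₀ → p ≡ s
  p≡s {p} {s} {z₀} 2≤p 2≤s z₀P with z₁ , z₁P ← InP-transpose comm z₀P
    with z₀ ≟ᶠ z₁
  ... | yes z₀≡z₁ = pred≡⇒≡ 2≤p 2≤s (cong proj₂ (proj₁ (InP-types-≡ z₀≡z₁ z₀P z₁P)))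
  ... | no z₀≢z₁ = pred≡⇒≡ 2≤p 2≤s (
    [ (λ z₀↩ → let p∸1≡1 , s∸1≡1 = OnReturnPath⇒types≡1 z₀↩ z₀P in trans p∸1≡1 (sym s∸1≡1))
    , (λ z₁↩ → let s∸1≡1 , p∸1≡1 = OnReturnPath⇒types≡1 z₁↩ z₁P in trans p∸1≡1 (sym s∸1≡1))
    ]′ (Common-pair⇒OnReturnPath (InP₁⇒Common z₀P) (InP₁⇒Common z₁P) z₀≢z₁))

  -- c′ ∈ P_{b,a}(x,y) and c″ ∈ P_{b⁻¹,a⁻¹}(x,y) are common neighbours too, hence lie in {z₀, c}.
  Common⇒InP₁₁ : ∀ {z₀ c} → InP A (1 , 1) (1 , 1) x y z₀ → Common c → InP A (1 , 1) (1 , 1) x y c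
  Common⇒InP₁₁ {z₀} {c} z₀P c∼ with c ≟ᶠ z₀
  ... | yes refl   = z₀P
  ... | no  c≢z₀ with c′ , c′P ← InP-transpose comm {z = c} (refl , refl)
                 | c″ , c″P ← InP-reverse {z = c} (trans (cong swap xy) (sym xy)) (refl , refl)
    = forced (locate (proj₂ (Common⁻ c∼)) (proj₁ (Common⁻ c∼)) c′P)
             (locate (Adjacent-swap (proj₂ (Common⁻ c∼))) (Adjacent-swap (proj₁ (Common⁻ c∼))) c″P)
    where
    a = tdist A x c
    b = tdist A c y

    locate : ∀ {i j w} → Adjacent i → Adjacent j → InP A i j x y w →
             (i ≡ (1 , 1) × j ≡ (1 , 1)) ⊎ (i ≡ a × j ≡ b)
    locate adj-i adj-j wP =
      Sum.map (λ w≡z₀ → InP-types-≡ w≡z₀ wP z₀P) (λ w≡c → InP-types-≡ w≡c wP (refl , refl))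
      (Common-pair (InP₁⇒Common z₀P) c∼ (c≢z₀ ∘ sym) (InP⇒Common adj-i adj-j wP))

    forced : (b ≡ (1 , 1) × a ≡ (1 , 1)) ⊎ (b ≡ a × a ≡ b) →
             (swap b ≡ (1 , 1) × swap a ≡ (1 , 1)) ⊎ (swap b ≡ a × swap a ≡ b) →
             a ≡ (1 , 1) × b ≡ (1 , 1)
    forced (inj₁ (b≡11 , a≡11)) _ = a≡11 , b≡11
    forced (inj₂ _) (inj₁ (b⁻≡11 , a⁻≡11)) = cong swap a⁻≡11 , cong swap b⁻≡11
    forced (inj₂ (b≡a , _)) (inj₂ (b⁻≡a , _)) = a≡11 , trans b≡a a≡11
      where
      a≡11 : a ≡ (1 , 1)
      a≡11 = Adjacent-symmetric (proj₁ (Common⁻ c∼)) (trans (cong swap (sym b≡a)) b⁻≡a)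

  p≡2⇒count≡2 : ∀ {z₀} → InP A (1 , 1) (1 , 1) x y z₀ → pᵂ (2 , 2) (1 , 1) (1 , 1) ≡ 2
  p≡2⇒count≡2 z₀P = begin
    pᵂ (2 , 2) (1 , 1) (1 , 1)       ≡⟨ p≡count xy z₀P ⟩
    count (InP? A (1 , 1) (1 , 1) x y) ≡⟨ cong length (filter-≐ _ Common? InP₁₁≐Common (allFin n)) ⟩
    count Common?                      ≡⟨ count-Common ⟩
    2                                  ∎
    where
    open ≡-Reasoning
    InP₁₁≐Common : InP A (1 , 1) (1 , 1) x y ≐ Common
    InP₁₁≐Common = InP₁⇒Common , Common⇒InP₁₁ z₀P

  InP₁⇒dist≤3 : ∀ {q r z} → InP A (1 , q) (1 , r) x y z → q ≤ 3
  InP₁⇒dist≤3 {z = z} (xz , zy) with u , y→u , u→x ← return-vertex =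
    subst (_≤ 3) (cong proj₂ xz) (dist-minimal A
      (within-snoc A 2 z u x (within-snoc A 1 z y u (within-snoc A 0 z z y (within-refl A z) z→y) y→u) u→x))
    where
    z→y : T (A z y)
    z→y = dist≡1⇒arc A 1<n (cong proj₁ zy)

  p≢2⇒p≡3⊎p≡4 : ∀ {p r z₀} → 2 ≤ p → p ≢ 2 → InP A (1 , p ∸ 1) (1 , r) x y z₀ → p ≡ 3 ⊎ p ≡ 4
  p≢2⇒p≡3⊎p≡4 2≤p p≢2 z₀P = pred≤3⇒≡3⊎≡4 2≤p p≢2 (InP₁⇒dist≤3 z₀P)

  p≢2⇒count≡1 : ∀ {p z₀} → 2 ≤ p → p ≢ 2 → InP A (1 , p ∸ 1) (1 , p ∸ 1) x y z₀ →
                pᵂ (2 , 2) (1 , p ∸ 1) (1 , p ∸ 1) ≡ 1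
  p≢2⇒count≡1 {p} {z₀} 2≤p p≢2 z₀P = trans (p≡count xy z₀P) (count≡1 (InP? A _ _ x y) z₀P only-z₀)
    where
    only-z₀ : ∀ {c} → InP A (1 , p ∸ 1) (1 , p ∸ 1) x y c → c ≡ z₀
    only-z₀ {c} cP with c ≟ᶠ z₀
    ... | yes c≡z₀ = c≡z₀
    ... | no  c≢z₀ = contradiction (pred≡⇒≡ 2≤p ≤-refl p∸1≡1) p≢2
      where
      p∸1≡1 : p ∸ 1 ≡ 1
      p∸1≡1 = [ (λ c↩ → proj₁ (OnReturnPath⇒types≡1 c↩ cP))
              , (λ z₀↩ → proj₁ (OnReturnPath⇒types≡1 z₀↩ z₀P)) ]′
                (Common-pair⇒OnReturnPath (InP₁⇒Common cP) (InP₁⇒Common z₀P) c≢z₀)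

lemma3p1 : ∀ {n : ℕ} (A : Adj n) (W : WeaklyDistanceRegular A) → Commutative W →
    DistanceRegular (underlying A) → C2 (underlying A) 2 →
    ∀ (p s : ℕ) → 2 ≤ p → 2 ≤ s →
    InTDist A (1 , p ∸ 1) → InTDist A (1 , s ∸ 1) → InTDist A (2 , 2) →
    WeaklyDistanceRegular.p W (2 , 2) (1 , p ∸ 1) (1 , s ∸ 1) ≢ 0 →
    (p ≡ s) ×
    ((p ≡ 2 × WeaklyDistanceRegular.p W (2 , 2) (1 , 1) (1 , 1) ≡ 2) ⊎
    ((p ≡ 3 ⊎ p ≡ 4) × WeaklyDistanceRegular.p W (2 , 2) (1 , p ∸ 1) (1 , p ∸ 1) ≡ 1))
lemma3p1 A W comm _ c₂≡2 p s 2≤p 2≤s inα inβ (x , y , xy) p≢0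
  with z₀ , z₀P ← IntersectionNumbers.p≢0⇒InP W inα inβ xy p≢0
  with 2<n ← dist≡2⇒dist≡1⇒2<n A (cong proj₁ xy) (cong proj₁ (proj₁ z₀P))
  with refl ← AtTypeTwoTwo.p≡s W comm c₂≡2 xy 2<n 2≤p 2≤s z₀P
  with p ≟ℕ 2
... | yes refl = refl , inj₁ (refl , p≡2⇒count≡2 z₀P)
  where open AtTypeTwoTwo W comm c₂≡2 xy 2<n
... | no  p≢2  = refl , inj₂ (p≢2⇒p≡3⊎p≡4 2≤p p≢2 z₀P , p≢2⇒count≡1 2≤p p≢2 z₀P)
  where open AtTypeTwoTwo W comm c₂≡2 xy 2<n
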